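{- Let $G$ be an endofunctor on $\mathbf{Sets}$ that preserves weak pullbacks, and let $\mathcal C$ be a class of finite $G$-coalgebras closed under isomorphism. Then: (1) If for every $X\in\mathcal C$ and every nontrivial bisimulation equivalence $R\subseteq X\times X$ there is a nontrivial $R$-rerouting $U$ of $X$ with $U\in\mathcal C$, then $\mathcal C$ is closed under homomorphic images. (2) If for every $X\in\mathcal C$ with $X\not\cong X/{\underline{\leftrightarrow}}$ there is a nontrivial bisimulation rerouting $U$ of $X$ with $U\in\mathcal C$, then $\mathcal C$ is closed under bisimulation collapses.
   Context: A $G$-coalgebra is $(X,\delta_X)$ with $\delta_X\colon X\to GX$; a homomorphism $h$ satisfies $\delta_Y\circ h=G(h)\circ\delta_X$; $X\cong Y$ means there is a bijective homomorphism. A bisimulation between $X$ and $Y$ is a relation $R\subseteq X\times Y$ carrying a coalgebra structure for which both projections are homomorphisms; bisimilarity $\underline{\leftrightarrow}$ on $X$ is the union of all bisimulations on $X$. A bisimulation equivalence on $X$ is a bisimulation $R\subseteq X\times X$ that is an equivalence relation; $X/R$ denotes the quotient coalgebra making the quotient map a homomorphism; $R$ is nontrivial if $X\not\cong X/R$ (i.e. $R$ relates some distinct states). $X/{\underline{\leftrightarrow}}$ is the bisimulation collapse of $X$. A splitting is a pair $(i,j)$ with $i\colon U\hookrightarrow X$ the inclusion of a subset and $j\colon X\to U$ with $j\circ i=\mathrm{id}_U$; the rerouting of $(X,\delta)$ by $(i,j)$ is $X[i,j]=(U,G(j)\circ\delta\circ i)$. It is an $R$-rerouting if $R$ is a bisimulation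 and $\ker(j)=\{(x,x')\mid j(x)=j(x')\}\subseteq R$; a bisimulation rerouting if this holds with $R=\underline{\leftrightarrow}$; it is nontrivial if $U\ne X$. $\mathcal C$ is closed under homomorphic images if $Y\in\mathcal C$ whenever $X\in\mathcal C$ and there is a surjective homomorphism $X\to Y$; closed under bisimulation collapses if $X/{\underline{\leftrightarrow}}\in\mathcal C$ for all $X\in\mathcal C$. -}

module Defs where

open import Level using (Level) renaming (suc to lsuc; zero to lzero)
open import Data.Nat using (ℕ)
open import Data.Fin using (Fin)
open import Data.Product using (Σ; Σ-syntax; ∃; ∃-syntax; _×_; _,_; proj₁; proj₂)
open import Function using (_∘_; id)
open import Function.Bundles using (_↔_)
open import Function.Definitions using (Bijective; Surjective)
open import Relation.Binary.PropositionalEquality using (_≡_)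
open import Relation.Binary.Structures using (IsEquivalence)
open import Relation.Nullary using (¬_)

-- An endofunctor on Sets (Agda's Set), with the functor laws stated pointwise
-- (functions in Sets are equal iff extensionally equal, hence fmap-cong).
record SetFunctor : Set₁ where
  field
    F       : Set → Set
    fmap    : {A B : Set} → (A → B) → F A → F B
    fmap-id : {A : Set} (x : F A) → fmap id x ≡ x
    fmap-∘  : {A B C : Set} (g : B → C) (f : A → B) (x : F A) →
              fmap (g ∘ f) x ≡ fmap g (fmap f x)
    fmap-cong : {A B : Set} {f g : A → B} → (∀ a → f a ≡ g a) →
                (x : F A) → fmap f x ≡ fmap g x

IsWeakPullback : {A B C P : Set} (f : A → C) (g : B → C) (p₁ : P → A) (p₂ : P → B) → Set
IsWeakPullback {A} {B} {C} {P} f g p₁ p₂ =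
  (a : A) (b : B) → f a ≡ g b → Σ[ p ∈ P ] (p₁ p ≡ a × p₂ p ≡ b)

PreservesWeakPullbacks : SetFunctor → Set₁
PreservesWeakPullbacks G =
  {A B C P : Set} (f : A → C) (g : B → C) (p₁ : P → A) (p₂ : P → B) →
  (∀ p → f (p₁ p) ≡ g (p₂ p)) →
  IsWeakPullback f g p₁ p₂ →
  IsWeakPullback (fmap f) (fmap g) (fmap p₁) (fmap p₂)
  where open SetFunctor G

module _ (G : SetFunctor) where
  open SetFunctor G

  record Coalg : Set₁ where
    constructor coalg
    field
      Carrier : Set
      δ       : Carrier → F Carrier

  open Coalg

  IsHom : (X Y : Coalg) → (Carrier X → Carrier Y) → Set
  IsHom X Y h = ∀ x → δ Y (h x) ≡ fmap h (δ X x)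

  _≅_ : Coalg → Coalg → Set
  X ≅ Y = Σ[ h ∈ (Carrier X → Carrier Y) ] (IsHom X Y h × Bijective _≡_ _≡_ h)

  Finite : Coalg → Set
  Finite X = Σ[ n ∈ ℕ ] (Carrier X ↔ Fin n)

  -- a relation R ⊆ X × Y, i.e. a proposition-valued binary relation
  IsSubsetRel : {A B : Set} → (A → B → Set) → Set
  IsSubsetRel R = ∀ a b (r s : R a b) → r ≡ s

  Graph : {A B : Set} → (A → B → Set) → Set
  Graph {A} {B} R = Σ[ p ∈ A × B ] R (proj₁ p) (proj₂ p)

  IsBisimulation : (X Y : Coalg) → (Carrier X → Carrier Y → Set) → Set
  IsBisimulation X Y R =
    IsSubsetRel R ×
    Σ[ γ ∈ (Graph R → F (Graph R)) ]
      (IsHom (coalg (Graph R) γ) X (proj₁ ∘ proj₁) ×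
       IsHom (coalg (Graph R) γ) Y (proj₂ ∘ proj₁))

  Bisimilar : (X : Coalg) → Carrier X → Carrier X → Set₁
  Bisimilar X x x' =
    Σ[ R ∈ (Carrier X → Carrier X → Set) ] (IsBisimulation X X R × R x x')

  IsBisimEquiv : (X : Coalg) → (Carrier X → Carrier X → Set) → Set
  IsBisimEquiv X R = IsBisimulation X X R × IsEquivalence R

  NontrivialRel : {ℓ : Level} {A : Set} → (A → A → Set ℓ) → Set ℓ
  NontrivialRel {A = A} R = Σ[ x ∈ A ] Σ[ x' ∈ A ] (¬ x ≡ x' × R x x')

  -- A splitting (i, j) of X: U ⊆ X a subset (a proposition-valued predicate P),
  -- i the inclusion Σ X P → X (= proj₁), and j : X → U with j ∘ i = id.
  record Splitting (X : Coalg) : Set₁ where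
    field
      P       : Carrier X → Set
      P-prop  : ∀ x (p q : P x) → p ≡ q
      j       : Carrier X → Σ (Carrier X) P
      j∘i≡id  : ∀ u → j (proj₁ u) ≡ u

    U : Set
    U = Σ (Carrier X) P

    i : U → Carrier X
    i = proj₁

  reroute : (X : Coalg) → Splitting X → Coalg
  reroute X s = coalg (Splitting.U s) (fmap (Splitting.j s) ∘ δ X ∘ Splitting.i s)

  -- ker(j) ⊆ R   (for R possibly large, e.g. bisimilarity)
  KerWithin : {ℓ : Level} (X : Coalg) → Splitting X → (Carrier X → Carrier X → Set ℓ) → Set ℓ
  KerWithin X s R = ∀ x x' → Splitting.j s x ≡ Splitting.j s x' → R x x'

  NontrivialSplitting : (X : Coalg) → Splitting X → Set
  NontrivialSplitting X s = Σ[ x ∈ Carrier X ] ¬ Splitting.P s x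

  ClosedUnderHomImages : (Coalg → Set₁) → Set₁
  ClosedUnderHomImages C =
    (X Y : Coalg) (h : Carrier X → Carrier Y) →
    C X → IsHom X Y h → Surjective _≡_ _≡_ h → C Y

  -- Y (with q) is the bisimulation collapse X/↔ : q is a surjective homomorphism
  -- whose kernel is exactly bisimilarity (this determines X/↔ up to isomorphism).
  IsBisimCollapse : (X Y : Coalg) → (Carrier X → Carrier Y) → Set₁
  IsBisimCollapse X Y q =
    IsHom X Y q × Surjective _≡_ _≡_ q ×
    (∀ x x' → (q x ≡ q x' → Bisimilar X x x') × (Bisimilar X x x' → q x ≡ q x'))

  ClosedUnderCollapses : (Coalg → Set₁) → Set₁
  ClosedUnderCollapses C =
    (X Y : Coalg) (q : Carrier X → Carrier Y) → C X → IsBisimCollapse X Y q → C Y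

{-# OPTIONS --safe #-}
-- Both parts go by induction on the size of the finite coalgebra X ∈ C mapped onto Y by a
-- surjective homomorphism (resp. a collapse map) h. If h is injective then X ≅ Y. Otherwise ker h
-- is a nontrivial bisimulation equivalence (kernels of homomorphisms are bisimulations because G
-- preserves weak pullbacks), resp. ker h is bisimilarity, and the hypothesis yields a rerouting
-- U ∈ C on a proper subset of X. As ker j ⊆ ker h, h restricts to a surjective homomorphism
-- U → Y, and the induction hypothesis applies to U. For (2) this restriction is even the collapse
-- of U: the collapse Y has no nontrivial bisimulations, and every bisimulation on U maps to one on Y.
module Submission where

open import Defs
open import Data.Bool.Properties using (T-irrelevant)
open import Data.Empty using (⊥-elim)
open import Data.Fin using (Fin; zero; suc)
open import Data.Fin.Properties using (any?; injective⇒≤; inj⇒≟; sequence)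
open import Data.Nat using (ℕ; _<_)
import Data.Nat as ℕ
open import Data.Nat.Induction using (<-wellFounded)
open import Data.Product using (Σ; Σ-syntax; ∃; _×_; _,_; proj₁; proj₂)
open import Data.Sum using (_⊎_; inj₁; inj₂; [_,_]′)
open import Effect.Monad using (RawMonad)
open import Function using (_∘_; id)
open import Function.Bundles using (_↔_; Inverse; Injection)
open import Function.Definitions using (Injective; Surjective)
open import Function.Properties.Inverse using (↔⇒↣; ↔-sym)
open import Induction.WellFounded using (Acc; acc)
import Relation.Binary.Construct.On as On
open import Relation.Binary.Definitions using (DecidableEquality)
open import Relation.Binary.PropositionalEquality
open import Relation.Nullary using (¬_; Dec; yes; no; Irrelevant)
open import Relation.Nullary.Decidable
  using (True; toWitness; fromWitness; map′; ¬?; _×-dec_; decidable-stable; ¬¬-excluded-middle)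
open import Relation.Nullary.Negation using (¬¬-Monad; ¬¬-map)
open import Relation.Unary using (Decidable)
open import Level using (Level; _⊔_; 0ℓ) renaming (suc to lsuc)

module _ {A B : Set} {h : A → B} (h-surj : Surjective _≡_ _≡_ h) where

  section : B → A
  section = proj₁ ∘ h-surj

  section-inverse : ∀ y → h (section y) ≡ y
  section-inverse y = proj₂ (h-surj y) refl

  ≟-via-surjection : DecidableEquality A → DecidableEquality B
  ≟-via-surjection _≟_ y y' =
    map′ (λ e → trans (sym (section-inverse y)) (trans (cong h e) (section-inverse y')))
         (cong section) (section y ≟ section y')

DirectImage : {A B : Set} → (A → B) → (A → A → Set) → B → B → Set
DirectImage {A} f R b b' = Σ[ a ∈ A ] Σ[ a' ∈ A ] (R a a' × f a ≡ b × f a' ≡ b')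

proj₁-injective : {A : Set} {P : A → Set} → (∀ x → Irrelevant (P x)) →
  {u v : Σ A P} → proj₁ u ≡ proj₁ v → u ≡ v
proj₁-injective P-irrelevant {x , p} {.x , q} refl = cong (x ,_) (P-irrelevant x p q)

module _ {A : Set} {n : ℕ} (A↔Fin : A ↔ Fin n) where
  open Inverse A↔Fin

  ≟-↔Fin : DecidableEquality A
  ≟-↔Fin = inj⇒≟ (↔⇒↣ A↔Fin)

  any?-↔Fin : {P : A → Set} → Decidable P → Dec (∃ P)
  any?-↔Fin {P} P? = map′ (λ (i , p) → from i , p)
    (λ (x , p) → to x , subst P (sym (strictlyInverseʳ x)) p) (any? (P? ∘ from))

  ¬¬-∀-↔Fin : {P : A → Set} → (∀ x → ¬ ¬ P x) → ¬ ¬ (∀ x → P x)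
  ¬¬-∀-↔Fin {P} ¬¬P = ¬¬-map (λ ∀P x → subst P (strictlyInverseʳ x) (∀P (to x)))
    (sequence (RawMonad.rawApplicative ¬¬-Monad) (¬¬P ∘ from))

  injective-or-collision : {B : Set} → DecidableEquality B → (h : A → B) →
    Injective _≡_ _≡_ h ⊎ Σ[ x ∈ A ] Σ[ x' ∈ A ] (x ≢ x' × h x ≡ h x')
  injective-or-collision _≟B_ h
    with any?-↔Fin (λ x → any?-↔Fin (λ x' → ¬? (≟-↔Fin x x') ×-dec (h x ≟B h x')))
  ... | yes collision = inj₂ collision
  ... | no ¬collision = inj₁ λ {x} {x'} hx≡hx' →
    decidable-stable (≟-↔Fin x x') (λ x≢x' → ¬collision (x , x' , x≢x' , hx≡hx'))

  surjection-injective-or-collision : {B : Set} {h : A → B} → Surjective _≡_ _≡_ h →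
    Injective _≡_ _≡_ h ⊎ Σ[ x ∈ A ] Σ[ x' ∈ A ] (x ≢ x' × h x ≡ h x')
  surjection-injective-or-collision {h = h} h-surj =
    injective-or-collision (≟-via-surjection h-surj ≟-↔Fin) h

  proper-subset-smaller : {P : A → Set} {m : ℕ} → (∀ x → Irrelevant (P x)) →
    Σ A P ↔ Fin m → Σ[ x ∈ A ] ¬ P x → m < n
  proper-subset-smaller {P} {m} P-irrelevant S↔Fin (x₀ , ¬Px₀) = injective⇒≤ f-injective
    where
    element : Fin m → A
    element = proj₁ ∘ Inverse.from S↔Fin

    element-injective : Injective _≡_ _≡_ element
    element-injective e =
      Injection.injective (↔⇒↣ (↔-sym S↔Fin)) (proj₁-injective P-irrelevant e)

    to-injective : Injective _≡_ _≡_ to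
    to-injective = Injection.injective (↔⇒↣ A↔Fin)

    x₀-outside : ∀ k → x₀ ≢ element k
    x₀-outside k x₀≡ = ¬Px₀ (subst P (sym x₀≡) (proj₂ (Inverse.from S↔Fin k)))

    f : Fin (ℕ.suc m) → Fin n
    f zero    = to x₀
    f (suc k) = to (element k)

    f-injective : Injective _≡_ _≡_ f
    f-injective {zero}  {zero}   _ = refl
    f-injective {zero}  {suc k}  e = ⊥-elim (x₀-outside k (to-injective e))
    f-injective {suc k} {zero}   e = ⊥-elim (x₀-outside k (sym (to-injective e)))
    f-injective {suc k} {suc k'} e = cong suc (element-injective (to-injective e))

module _ (G : SetFunctor) where
  open SetFunctor G
  open Coalg

  private
    variable
      A B C : Set
      α : F A
      β : F B

  π₁ : {R : A → B → Set} → Graph G R → A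
  π₁ = proj₁ ∘ proj₁

  π₂ : {R : A → B → Set} → Graph G R → B
  π₂ = proj₂ ∘ proj₁

  RelLift : (A → B → Set) → F A → F B → Set
  RelLift R α β = Σ[ w ∈ F (Graph G R) ] (fmap π₁ w ≡ α × fmap π₂ w ≡ β)

  fmap-square : {D : Set} (p : A → B) (k : B → C) (m : A → D) (p' : D → C) →
    (∀ a → p' (m a) ≡ k (p a)) → (x : F A) {y : F B} → fmap p x ≡ y →
    fmap p' (fmap m x) ≡ fmap k y
  fmap-square p k m p' commutes x {y} px≡y = begin
    fmap p' (fmap m x) ≡⟨ sym (fmap-∘ p' m x) ⟩
    fmap (p' ∘ m) x    ≡⟨ fmap-cong commutes x ⟩
    fmap (k ∘ p) x     ≡⟨ fmap-∘ k p x ⟩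
    fmap k (fmap p x)  ≡⟨ cong (fmap k) px≡y ⟩
    fmap k y           ∎
    where open ≡-Reasoning

  span-lift : (R : B → C → Set) (f : A → B) (g : A → C) →
    (∀ a → R (f a) (g a)) → (x : F A) → RelLift R (fmap f x) (fmap g x)
  span-lift {A = A} R f g r x = fmap m x , sym (fmap-∘ π₁ m x) , sym (fmap-∘ π₂ m x)
    where
    m : A → Graph G R
    m a = (f a , g a) , r a

  lift-map : {D : Set} {R : A → B → Set} {S : C → D → Set} (f : A → C) (g : B → D) →
    (∀ {a b} → R a b → S (f a) (g b)) → RelLift R α β → RelLift S (fmap f α) (fmap g β)
  lift-map {R = R} {S = S} f g R⇒S (w , w₁ , w₂) =
    fmap m w ,
    fmap-square π₁ f m π₁ (λ _ → refl) w w₁ ,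
    fmap-square π₂ g m π₂ (λ _ → refl) w w₂
    where
    m : Graph G R → Graph G S
    m ((a , b) , r) = (f a , g b) , R⇒S r

  lift⇒isBisimulation : (X Y : Coalg G) (R : Carrier X → Carrier Y → Set) → IsSubsetRel G R →
    (∀ x y → R x y → RelLift R (δ X x) (δ Y y)) → IsBisimulation G X Y R
  lift⇒isBisimulation X Y R R-irrelevant lift =
    R-irrelevant ,
    (λ ((x , y) , r) → proj₁ (lift x y r)) ,
    (λ ((x , y) , r) → sym (proj₁ (proj₂ (lift x y r)))) ,
    (λ ((x , y) , r) → sym (proj₂ (proj₂ (lift x y r))))

  bisimulation-lift : {X Y : Coalg G} {R : Carrier X → Carrier Y → Set} →
    IsBisimulation G X Y R →
    ∀ {x y} → R x y → RelLift R (δ X x) (δ Y y)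
  bisimulation-lift (_ , γ , γ₁ , γ₂) {x} {y} r =
    γ ((x , y) , r) , sym (γ₁ ((x , y) , r)) , sym (γ₂ ((x , y) , r))

  ≡-isBisimulation : (X : Coalg G) → IsBisimulation G X X _≡_
  ≡-isBisimulation X = lift⇒isBisimulation X X _≡_ (λ { _ _ refl refl → refl }) diagonal
    where
    diagonal : ∀ x y → x ≡ y → RelLift _≡_ (δ X x) (δ X y)
    diagonal x .x refl =
      subst₂ (RelLift _≡_) (fmap-id (δ X x)) (fmap-id (δ X x))
        (span-lift _≡_ id id (λ _ → refl) (δ X x))

  image-isBisimulation : {U Y : Coalg G} (f : Carrier U → Carrier Y) → IsHom G U Y f →
    (B : Carrier U → Carrier U → Set) → IsBisimulation G U U B →
    (R : Carrier Y → Carrier Y → Set) → IsSubsetRel G R →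
    (∀ {y y'} → R y y' → DirectImage f B y y') →
    (∀ {u u'} → B u u' → R (f u) (f u')) →
    IsBisimulation G Y Y R
  image-isBisimulation {U} {Y} f f-hom B B-bisim R R-irrelevant R⊆image B⇒R =
    lift⇒isBisimulation Y Y R R-irrelevant lift
    where
    lift : ∀ y y' → R y y' → RelLift R (δ Y y) (δ Y y')
    lift y y' r with R⊆image r
    ... | u , u' , b , refl , refl =
      subst₂ (RelLift R) (sym (f-hom u)) (sym (f-hom u'))
        (lift-map f f B⇒R (bisimulation-lift B-bisim b))

  module _ {X Y : Coalg G} (s : Splitting G X) {h : Carrier X → Carrier Y}
           (ker-j⊆ker-h : KerWithin G X s (λ x x' → h x ≡ h x')) where
    open Splitting s

    h∘i∘j≗h : ∀ x → h (i (j x)) ≡ h x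
    h∘i∘j≗h x = ker-j⊆ker-h (i (j x)) x (j∘i≡id (j x))

    reroute-isHom : IsHom G X Y h → IsHom G (reroute G X s) Y (h ∘ i)
    reroute-isHom h-hom u = begin
      δ Y (h (i u))                     ≡⟨ h-hom (i u) ⟩
      fmap h (δ X (i u))                ≡⟨ fmap-cong (sym ∘ h∘i∘j≗h) (δ X (i u)) ⟩
      fmap (h ∘ i ∘ j) (δ X (i u))      ≡⟨ fmap-∘ (h ∘ i) j (δ X (i u)) ⟩
      fmap (h ∘ i) (fmap j (δ X (i u))) ∎
      where open ≡-Reasoning

    reroute-surjective : Surjective _≡_ _≡_ h → Surjective _≡_ _≡_ (h ∘ i)
    reroute-surjective h-surj y =
      j (section h-surj y) , λ { refl → trans (h∘i∘j≗h _) (section-inverse h-surj y) }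

  IsSimple : Coalg G → Set₁
  IsSimple Y = ∀ y y' → Bisimilar G Y y y' → y ≡ y'

  module _ {U Y : Coalg G} {m : ℕ} (U↔Fin : Carrier U ↔ Fin m)
           (_≟Y_ : DecidableEquality (Carrier Y))
           {f : Carrier U → Carrier Y} (f-hom : IsHom G U Y f) where

    -- The direct image of B must be truncated to a proposition-valued relation; we truncate it by
    -- deciding it, which needs B decidable. On a finite carrier that holds under a double negation,
    -- harmless here because the goal is a decidable equation.
    bisimilar⇒≡-intoSimple : IsSimple Y → ∀ u u' → Bisimilar G U u u' → f u ≡ f u'
    bisimilar⇒≡-intoSimple Y-simple u u' (B , B-bisim , b) =
      decidable-stable (f u ≟Y f u') (¬¬-map respects B-decidable)
      where
      B-decidable : ¬ ¬ (∀ u u' → Dec (B u u'))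
      B-decidable =
        ¬¬-∀-↔Fin U↔Fin (λ u → ¬¬-∀-↔Fin U↔Fin (λ u' → ¬¬-excluded-middle))

      respects : (∀ u u' → Dec (B u u')) → f u ≡ f u'
      respects B? = Y-simple (f u) (f u') (Image , Image-bisim , fromWitness (u , u' , b , refl , refl))
        where
        image? : ∀ y y' → Dec (DirectImage f B y y')
        image? y y' = any?-↔Fin U↔Fin λ u → any?-↔Fin U↔Fin λ u' →
          B? u u' ×-dec f u ≟Y y ×-dec f u' ≟Y y'

        Image : Carrier Y → Carrier Y → Set
        Image y y' = True (image? y y')

        Image-bisim : IsBisimulation G Y Y Image
        Image-bisim = image-isBisimulation f f-hom B B-bisim Image (λ _ _ → T-irrelevant)
          toWitness (λ b → fromWitness (_ , _ , b , refl , refl))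

  module _ (preserves-wp : PreservesWeakPullbacks G) where

    pullback-lift : (f : A → C) (g : B → C) → fmap f α ≡ fmap g β →
      RelLift (λ a b → f a ≡ g b) α β
    pullback-lift {α = α} {β = β} f g =
      preserves-wp f g π₁ π₂ proj₂ (λ a b e → ((a , b) , e) , refl , refl) α β

    lift-compose : {R : A → B → Set} {S : B → C → Set} {γ : F C} →
      RelLift R α β → RelLift S β γ → RelLift (λ a c → ∃ λ b → R a b × S b c) α γ
    lift-compose {α = α} {R = R} {S = S} {γ = γ} (v , v₁ , v₂) (w , w₁ , w₂) =
      glued (pullback-lift π₂ π₁ (trans v₂ (sym w₁)))
      where
      Matching : Graph G R → Graph G S → Set
      Matching r s = π₂ r ≡ π₁ s

      glue : Graph G Matching → Graph G (λ a c → ∃ λ b → R a b × S b c)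
      glue ((((a , b) , r) , ((b' , c) , s)) , b≡b') =
        (a , c) , b , r , subst (λ b → S b c) (sym b≡b') s

      glued : RelLift Matching v w → RelLift (λ a c → ∃ λ b → R a b × S b c) α γ
      glued (u , u₁ , u₂) =
        fmap glue u ,
        trans (fmap-square π₁ π₁ glue π₁ (λ _ → refl) u u₁) v₁ ,
        trans (fmap-square π₂ π₂ glue π₂ (λ _ → refl) u u₂) w₂

    preimage-isBisimulation : {X X' W : Coalg G}
      (f : Carrier X → Carrier W) (g : Carrier X' → Carrier W) →
      IsHom G X W f → IsHom G X' W g →
      (R : Carrier W → Carrier W → Set) → IsBisimulation G W W R →
      IsBisimulation G X X' (λ x x' → R (f x) (g x'))
    preimage-isBisimulation {X} {X'} {W} f g f-hom g-hom R R-bisim =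
      lift⇒isBisimulation X X' _ (λ x x' → proj₁ R-bisim (f x) (g x')) lift
      where
      lift : ∀ x x' → R (f x) (g x') → RelLift (λ x x' → R (f x) (g x')) (δ X x) (δ X' x')
      lift x x' r =
        subst₂ (RelLift _) (fmap-id (δ X x)) (fmap-id (δ X' x'))
          (lift-map id id along-graphs
            (lift-compose (lift-compose graph-f (bisimulation-lift R-bisim r)) graph-g))
        where
        graph-f : RelLift (λ a w → f a ≡ w) (δ X x) (δ W (f x))
        graph-f = subst₂ (RelLift _) (fmap-id (δ X x)) (sym (f-hom x))
          (span-lift _ id f (λ _ → refl) (δ X x))
        graph-g : RelLift (λ w b → w ≡ g b) (δ W (g x')) (δ X' x')
        graph-g = subst₂ (RelLift _) (sym (g-hom x')) (fmap-id (δ X' x'))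
          (span-lift _ g id (λ _ → refl) (δ X' x'))
        along-graphs : ∀ {a b} → (∃ λ w' → (∃ λ w → f a ≡ w × R w w') × w' ≡ g b) →
          R (f a) (g b)
        along-graphs (_ , (_ , refl , r) , refl) = r

    kernel-isBisimulation : {X Y : Coalg G} (h : Carrier X → Carrier Y) → IsHom G X Y h →
      IsBisimulation G X X (λ x x' → h x ≡ h x')
    kernel-isBisimulation {Y = Y} h h-hom =
      preimage-isBisimulation h h h-hom h-hom _≡_ (≡-isBisimulation Y)

    kernel-isBisimEquiv : {X Y : Coalg G} (h : Carrier X → Carrier Y) → IsHom G X Y h →
      IsBisimEquiv G X (λ x x' → h x ≡ h x')
    kernel-isBisimEquiv {Y = Y} h h-hom =
      kernel-isBisimulation {Y = Y} h h-hom , On.isEquivalence h isEquivalence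

    collapse-isSimple : {X Y : Coalg G} {q : Carrier X → Carrier Y} →
      IsBisimCollapse G X Y q → IsSimple Y
    collapse-isSimple {X} {Y} {q} (q-hom , q-surj , q-ker) y y' (R , R-bisim , r) = begin
      y                   ≡⟨ sym (section-inverse q-surj y) ⟩
      q (section q-surj y)  ≡⟨ proj₂ (q-ker _ _) preimages-bisimilar ⟩
      q (section q-surj y') ≡⟨ section-inverse q-surj y' ⟩
      y'                  ∎
      where
      open ≡-Reasoning
      preimages-bisimilar : Bisimilar G X (section q-surj y) (section q-surj y')
      preimages-bisimilar =
        _ , preimage-isBisimulation q q q-hom q-hom R R-bisim ,
        subst₂ R (sym (section-inverse q-surj y)) (sym (section-inverse q-surj y')) r

    reroute-isBisimCollapse : {X Y : Coalg G} {q : Carrier X → Carrier Y} {n m : ℕ} →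
      IsBisimCollapse G X Y q → Carrier X ↔ Fin n →
      (s : Splitting G X) → KerWithin G X s (Bisimilar G X) → Splitting.U s ↔ Fin m →
      IsBisimCollapse G (reroute G X s) Y (q ∘ Splitting.i s)
    reroute-isBisimCollapse {X} {Y} {q} q-collapse@(q-hom , q-surj , q-ker)
                            X↔Fin s ker-j⊆bisim U↔Fin =
      q∘i-hom ,
      reroute-surjective {Y = Y} s ker-j⊆ker-q q-surj ,
      λ u u' → (λ e → _ , kernel-isBisimulation {Y = Y} (q ∘ Splitting.i s) q∘i-hom , e) ,
               bisimilar⇒≡-intoSimple {Y = Y} U↔Fin _≟Y_ q∘i-hom
                 (collapse-isSimple {X = X} q-collapse) u u'
      where
      ker-j⊆ker-q : KerWithin G X s (λ x x' → q x ≡ q x')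
      ker-j⊆ker-q x x' e = proj₂ (q-ker x x') (ker-j⊆bisim x x' e)
      q∘i-hom : IsHom G (reroute G X s) Y (q ∘ Splitting.i s)
      q∘i-hom = reroute-isHom {Y = Y} s ker-j⊆ker-q q-hom
      _≟Y_ : DecidableEquality (Carrier Y)
      _≟Y_ = ≟-via-surjection q-surj (≟-↔Fin X↔Fin)

module _ {G : SetFunctor} (C : Coalg G → Set₁) (finite : ∀ X → C X → Finite G X) where
  open Coalg

  size : {X : Coalg G} → C X → ℕ
  size {X} X∈C = proj₁ (finite X X∈C)

  Descending : {ℓ : Level} {Y : Coalg G} →
    ((X : Coalg G) → (Carrier X → Carrier Y) → Set ℓ) → Set (lsuc 0ℓ ⊔ ℓ)
  Descending {Y = Y} Φ =
    ∀ X h (X∈C : C X) → Φ X h →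
      C Y ⊎ Σ[ U ∈ Coalg G ] Σ[ U∈C ∈ C U ]
              (size U∈C < size X∈C × Σ[ h' ∈ (Carrier U → Carrier Y) ] Φ U h')

  descent : {ℓ : Level} {Y : Coalg G} (Φ : (X : Coalg G) → (Carrier X → Carrier Y) → Set ℓ)
    → Descending Φ → ∀ X h → C X → Φ X h → C Y
  descent {Y = Y} Φ step X h X∈C = go X h X∈C (<-wellFounded (size X∈C))
    where
    go : ∀ X h (X∈C : C X) → Acc _<_ (size X∈C) → Φ X h → C Y
    go X h X∈C (acc smaller) φ with step X h X∈C φ
    ... | inj₁ Y∈C = Y∈C
    ... | inj₂ (U , U∈C , U<X , h' , φ') = go U h' U∈C (smaller U<X) φ'

module _ (G : SetFunctor) (preserves-wp : PreservesWeakPullbacks G) (C : Coalg G → Set₁)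
         (finite : ∀ X → C X → Finite G X) (C-iso : ∀ X Y → C X → _≅_ G X Y → C Y) where
  open Coalg

  rerouting-descends : {ℓ ℓ' : Level} {X Y : Coalg G} (X∈C : C X)
    {R : Carrier X → Carrier X → Set ℓ}
    (Φ : (U : Coalg G) → (Carrier U → Carrier Y) → Set ℓ') (h : Carrier X → Carrier Y) →
    (∀ s → KerWithin G X s R → C (reroute G X s) → Φ (reroute G X s) (h ∘ Splitting.i s)) →
    Σ[ s ∈ Splitting G X ] (KerWithin G X s R × NontrivialSplitting G X s × C (reroute G X s)) →
    Σ[ U ∈ Coalg G ] Σ[ U∈C ∈ C U ]
      (size C finite U∈C < size C finite X∈C × Σ[ h' ∈ (Carrier U → Carrier Y) ] Φ U h')
  rerouting-descends {X = X} X∈C Φ h transfer (s , ker-j⊆R , s-nontrivial , U∈C) =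
    reroute G X s , U∈C ,
    proper-subset-smaller (proj₂ (finite X X∈C)) (Splitting.P-prop s)
      (proj₂ (finite (reroute G X s) U∈C)) s-nontrivial ,
    h ∘ Splitting.i s , transfer s ker-j⊆R U∈C

  closedUnderHomImages :
    (∀ X → C X → (R : Carrier X → Carrier X → Set) →
      IsBisimEquiv G X R → NontrivialRel G R →
      Σ[ s ∈ Splitting G X ]
        (KerWithin G X s R × NontrivialSplitting G X s × C (reroute G X s))) →
    ClosedUnderHomImages G C
  closedUnderHomImages reroutable X Y h X∈C h-hom h-surj =
    descent C finite Φ step X h X∈C (h-hom , h-surj)
    where
    Φ : (X : Coalg G) → (Carrier X → Carrier Y) → Set
    Φ X h = IsHom G X Y h × Surjective _≡_ _≡_ h

    step : Descending C finite Φ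
    step X h X∈C (h-hom , h-surj) =
      [ (λ (h-inj : Injective _≡_ _≡_ h) → inj₁ (C-iso X Y X∈C (h , h-hom , h-inj , h-surj)))
      , (λ collision → inj₂ (rerouting-descends {Y = Y} X∈C Φ h
          (λ s ker-j⊆ker-h _ → reroute-isHom G {Y = Y} s ker-j⊆ker-h h-hom ,
                                reroute-surjective G {Y = Y} s ker-j⊆ker-h h-surj)
          (reroutable X X∈C _ (kernel-isBisimEquiv G preserves-wp {Y = Y} h h-hom) collision)))
      ]′ (surjection-injective-or-collision (proj₂ (finite X X∈C)) h-surj)

  closedUnderCollapses :
    (∀ X → C X → NontrivialRel G (Bisimilar G X) →
      Σ[ s ∈ Splitting G X ]
        (KerWithin G X s (Bisimilar G X) × NontrivialSplitting G X s × C (reroute G X s))) →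
    ClosedUnderCollapses G C
  closedUnderCollapses reroutable X Y q X∈C q-collapse =
    descent C finite Φ step X q X∈C q-collapse
    where
    Φ : (X : Coalg G) → (Carrier X → Carrier Y) → Set₁
    Φ X q = IsBisimCollapse G X Y q

    step : Descending C finite Φ
    step X q X∈C q-collapse@(q-hom , q-surj , q-ker) =
      [ (λ (q-inj : Injective _≡_ _≡_ q) → inj₁ (C-iso X Y X∈C (q , q-hom , q-inj , q-surj)))
      , (λ (x , x' , x≢x' , qx≡qx') → inj₂ (rerouting-descends {Y = Y} X∈C Φ q
          (λ s ker-j⊆bisim U∈C → reroute-isBisimCollapse G preserves-wp {Y = Y} q-collapse
             (proj₂ (finite X X∈C)) s ker-j⊆bisim (proj₂ (finite (reroute G X s) U∈C)))
          (reroutable X X∈C (x , x' , x≢x' , proj₁ (q-ker x x') qx≡qx'))))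
      ]′ (surjection-injective-or-collision (proj₂ (finite X X∈C)) q-surj)

theorem4p3 : (G : SetFunctor) → PreservesWeakPullbacks G →
    (C : Coalg G → Set₁) →
    (∀ X → C X → Finite G X) →
    (∀ X Y → C X → _≅_ G X Y → C Y) →
    ((∀ X → C X → (R : Coalg.Carrier X → Coalg.Carrier X → Set) →
        IsBisimEquiv G X R → NontrivialRel G R →
        Σ[ s ∈ Splitting G X ]
          (KerWithin G X s R × NontrivialSplitting G X s × C (reroute G X s)))
      → ClosedUnderHomImages G C)
    ×
    ((∀ X → C X → NontrivialRel G (Bisimilar G X) →
        Σ[ s ∈ Splitting G X ]
          (KerWithin G X s (Bisimilar G X) × NontrivialSplitting G X s × C (reroute G X s)))
      → ClosedUnderCollapses G C)
theorem4p3 G preserves-wp C finite C-iso =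
  closedUnderHomImages G preserves-wp C finite C-iso ,
  closedUnderCollapses G preserves-wp C finite C-iso
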